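{- Let $G$ be a graph with $n$ edges and $m$ vertices, with a $\beta$-valuation $b$. Then there exists an $(n+1,m,1,1;G^b)$-EDF in $\mathbb{Z}_{n+1}$.
   Context: A $\beta$-valuation of a graph with $n$ edges is an injective $b:V\to\{0,\ldots,n\}$ such that the multiset of $|b(u)-b(v)|$ over edges $\{u,v\}$ is $\{1,\ldots,n\}$. $G^b$ (natural orientation) is the digraph obtained by orienting each edge towards the endpoint with larger $b$-label. $\Delta(A,B)=\{a-b:a\in A,b\in B\}$ (multiset). For a group $\Gamma$ of order $N$ and a digraph $H$ with $m$ vertices, a family $(A_v)_{v\in V(H)}$ of pairwise disjoint $l$-subsets of $\Gamma$ is an $(N,m,l,\lambda;H)$-EDF if $\bigcup_{(u,v)\in\overrightarrow{E}(H)}\Delta(A_v,A_u)=\lambda(\Gamma\setminus\{0\})$ as multisets; the first parameter is the group order. -}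

module Defs where

open import Data.Nat using (ℕ; zero; suc; _+_; _∸_; _<_; _<ᵇ_; ∣_-_∣; NonZero)
open import Data.Nat.DivMod using (_mod_)
open import Data.Bool using (if_then_else_)
open import Data.Fin using (Fin; toℕ)
open import Data.Fin.Properties using (_≟_)
open import Data.List using (List; []; _∷_; length; map; concatMap; concat; replicate; cartesianProductWith; upTo; allFin; filter)
open import Data.List.Relation.Unary.All using (All)
open import Data.List.Relation.Unary.AllPairs using (AllPairs)
open import Data.List.Relation.Unary.Unique.Propositional using (Unique)
open import Data.List.Membership.Propositional using (_∈_; _∉_)
open import Data.List.Relation.Binary.Permutation.Propositional using (_↭_)
open import Data.Product using (_×_; _,_; proj₁; proj₂)
open import Data.Sum using (_⊎_)
open import Relation.Binary.PropositionalEquality using (_≡_; _≢_)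
open import Relation.Nullary using (¬_)
open import Relation.Nullary.Decidable using (¬?)

-- Finite simple graphs on vertex set Fin m.
-- An edge {u,v} is stored as a pair (u , v); the list of edges has no
-- loops and no repeated edge (as an unordered pair).

SameEdge : ∀ {m} → Fin m × Fin m → Fin m × Fin m → Set
SameEdge (u , v) (u' , v') = (u ≡ u' × v ≡ v') ⊎ (u ≡ v' × v ≡ u')

record Graph (m : ℕ) : Set where
  field
    edges    : List (Fin m × Fin m)
    loopless : All (λ e → proj₁ e ≢ proj₂ e) edges
    simple   : AllPairs (λ e f → ¬ SameEdge e f) edges
open Graph public

nEdges : ∀ {m} → Graph m → ℕ
nEdges G = length (edges G)

Injective : ∀ {m k} → (Fin m → Fin k) → Set
Injective b = ∀ x y → b x ≡ b y → x ≡ y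

IsBetaValuation : ∀ {m} (G : Graph m) → (Fin m → Fin (suc (nEdges G))) → Set
IsBetaValuation G b =
  Injective b ×
  (map (λ e → ∣ toℕ (b (proj₁ e)) - toℕ (b (proj₂ e)) ∣) (edges G)
     ↭ map suc (upTo (nEdges G)))

-- Digraphs on vertex set Fin m: a list of arcs (tail , head).

record Digraph (m : ℕ) : Set where
  field
    arcs : List (Fin m × Fin m)
open Digraph public

orientEdge : ∀ {m k} → (Fin m → Fin k) → Fin m × Fin m → Fin m × Fin m
orientEdge b (u , v) = if toℕ (b u) <ᵇ toℕ (b v) then (u , v) else (v , u)

natOrient : ∀ {m} (G : Graph m) → (Fin m → Fin (suc (nEdges G))) → Digraph m
natOrient G b = record { arcs = map (orientEdge b) (edges G) }

-- The cyclic group ℤ_N, N ≥ 1, with carrier Fin N.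

_⊖_ : ∀ {N} .{{_ : NonZero N}} → Fin N → Fin N → Fin N
_⊖_ {N} a c = (toℕ a + (N ∸ toℕ c)) mod N

Δ : ∀ {N} .{{_ : NonZero N}} → List (Fin N) → List (Fin N) → List (Fin N)
Δ A B = cartesianProductWith _⊖_ A B

nonzeroElems : (N : ℕ) → List (Fin N)
nonzeroElems N = filter (λ x → ¬? (toℕ x Data.Nat.≟ 0)) (allFin N)

IsEDF : (N : ℕ) .{{_ : NonZero N}} {m : ℕ} (l lam : ℕ) (H : Digraph m)
        (A : Fin m → List (Fin N)) → Set
IsEDF N l lam H A =
  (∀ v → length (A v) ≡ l × Unique (A v)) ×
  (∀ u v → u ≢ v → ∀ x → x ∈ A u → x ∉ A v) ×
  (concatMap (λ a → Δ (A (proj₂ a)) (A (proj₁ a))) (arcs H)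
     ↭ concat (replicate lam (nonzeroElems N)))

{-# OPTIONS --safe #-}
-- Take the singletons A_v = {b(v)}.  An arc of G^b points from the smaller to
-- the larger label, so in ℤ_{n+1} it contributes exactly the edge label
-- |b(u) - b(v)|; these labels run once through 1, …, n, which are precisely
-- the non-zero residues modulo n + 1.
module Submission where

open import Defs
open import Data.Nat using (ℕ; suc; _+_; _∸_; _≤_; _<ᵇ_; ∣_-_∣; s<s; NonZero)
open import Data.Nat.Properties
  using (+-∸-assoc; +-∸-comm; m≤n⇒∣n-m∣≡n∸m; ∣-∣-comm; <ᵇ-reflects-<; <⇒≤; ≮⇒≥)
open import Data.Nat.DivMod using (_%_; _mod_; [m+n]%n≡m%n; m<n⇒m%n≡m)
open import Data.Fin as Fin using (Fin; toℕ)
open import Data.Fin.Properties using (toℕ-injective; toℕ-fromℕ<; toℕ<n)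
open import Data.List
  using (List; []; _∷_; [_]; _++_; map; concat; concatMap; replicate; applyUpTo; upTo; tabulate)
open import Data.List.Properties
  using (map-∘; map-cong; map-upTo; tabulate-cong; concatMap-map; concatMap-pure;
         filter-all; ++-identityʳ)
open import Data.List.Relation.Unary.All using ([])
open import Data.List.Relation.Unary.All.Properties using (tabulate⁺)
open import Data.List.Relation.Unary.AllPairs using ([]; _∷_)
open import Data.List.Relation.Unary.Any using (here)
open import Data.List.Membership.Propositional using (_∈_; _∉_)
open import Data.List.Relation.Binary.Permutation.Propositional
  using (_↭_; module PermutationReasoning)
open import Data.List.Relation.Binary.Permutation.Propositional.Properties using (map⁺)
open import Data.Product using (∃; _,_; proj₁; proj₂; _×_)
open import Function using (_∘_)
open import Relation.Binary.PropositionalEquality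
  using (_≡_; _≢_; refl; sym; trans; cong; module ≡-Reasoning)
open import Relation.Nullary.Reflects using (ofʸ; ofⁿ)

applyUpTo≡tabulate : ∀ {A : Set} (f : ℕ → A) n → applyUpTo f n ≡ tabulate (f ∘ toℕ {n})
applyUpTo≡tabulate f 0       = refl
applyUpTo≡tabulate f (suc n) = cong (f 0 ∷_) (applyUpTo≡tabulate (f ∘ suc) n)

module _ {N : ℕ} .{{_ : NonZero N}} where

  ≤⇒⊖≡∣-∣mod : (a c : Fin N) → toℕ c ≤ toℕ a → a ⊖ c ≡ ∣ toℕ a - toℕ c ∣ mod N
  ≤⇒⊖≡∣-∣mod a c c≤a = toℕ-injective (begin
    toℕ (a ⊖ c)                ≡⟨ toℕ-fromℕ< _ ⟩
    (toℕ a + (N ∸ toℕ c)) % N  ≡⟨ cong (_% N) (+-∸-assoc (toℕ a) (<⇒≤ (toℕ<n c))) ⟨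
    (toℕ a + N ∸ toℕ c) % N    ≡⟨ cong (_% N) (+-∸-comm N c≤a) ⟩
    (toℕ a ∸ toℕ c + N) % N    ≡⟨ [m+n]%n≡m%n (toℕ a ∸ toℕ c) N ⟩
    (toℕ a ∸ toℕ c) % N        ≡⟨ cong (_% N) (m≤n⇒∣n-m∣≡n∸m c≤a) ⟨
    ∣ toℕ a - toℕ c ∣ % N      ≡⟨ toℕ-fromℕ< _ ⟨
    toℕ (∣ toℕ a - toℕ c ∣ mod N) ∎)
    where open ≡-Reasoning

  module _ {m : ℕ} (b : Fin m → Fin N) where

    edgeLabel : Fin m × Fin m → ℕ
    edgeLabel (u , v) = ∣ toℕ (b u) - toℕ (b v) ∣

    arcDifference : Fin m × Fin m → Fin N
    arcDifference (u , v) = b v ⊖ b u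

    arcDifference-orientEdge : ∀ e → arcDifference (orientEdge b e) ≡ edgeLabel e mod N
    arcDifference-orientEdge (u , v)
      with toℕ (b u) <ᵇ toℕ (b v) | <ᵇ-reflects-< (toℕ (b u)) (toℕ (b v))
    ... | _ | ofʸ bu<bv = trans (≤⇒⊖≡∣-∣mod (b v) (b u) (<⇒≤ bu<bv))
                                (cong (_mod N) (∣-∣-comm (toℕ (b v)) (toℕ (b u))))
    ... | _ | ofⁿ bu≮bv = ≤⇒⊖≡∣-∣mod (b u) (b v) (≮⇒≥ bu≮bv)

    Δ-singletons-orientEdge : ∀ es →
      concatMap (λ a → Δ [ b (proj₂ a) ] [ b (proj₁ a) ]) (map (orientEdge b) es)
        ≡ map (_mod N) (map edgeLabel es)
    Δ-singletons-orientEdge es = begin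
      concatMap ([_] ∘ arcDifference) (map (orientEdge b) es)
        ≡⟨ concatMap-map ([_] ∘ arcDifference) (orientEdge b) es ⟩
      concatMap ([_] ∘ arcDifference ∘ orientEdge b) es
        ≡⟨ concatMap-map [_] (arcDifference ∘ orientEdge b) es ⟨
      concatMap [_] (map (arcDifference ∘ orientEdge b) es)
        ≡⟨ concatMap-pure _ ⟩
      map (arcDifference ∘ orientEdge b) es
        ≡⟨ map-cong arcDifference-orientEdge es ⟩
      map ((_mod N) ∘ edgeLabel) es
        ≡⟨ map-∘ es ⟩
      map (_mod N) (map edgeLabel es) ∎
      where open ≡-Reasoning

    singletons-disjoint : Injective b → ∀ u v → u ≢ v → ∀ x → x ∈ [ b u ] → x ∉ [ b v ]
    singletons-disjoint inj u v u≢v x (here x≡bu) (here x≡bv) =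
      u≢v (inj u v (trans (sym x≡bu) x≡bv))

nonzeroElems-suc : ∀ n → nonzeroElems (suc n) ≡ tabulate Fin.suc
nonzeroElems-suc n = filter-all _ (tabulate⁺ λ _ ())

map-mod-suc-upTo≡nonzeroElems : ∀ n →
  map (_mod suc n) (map suc (upTo n)) ≡ nonzeroElems (suc n)
map-mod-suc-upTo≡nonzeroElems n = begin
  map (_mod suc n) (map suc (upTo n))   ≡⟨ map-∘ (upTo n) ⟨
  map (λ k → suc k mod suc n) (upTo n)  ≡⟨ map-upTo _ n ⟩
  applyUpTo (λ k → suc k mod suc n) n   ≡⟨ applyUpTo≡tabulate _ n ⟩
  tabulate (λ i → suc (toℕ i) mod suc n) ≡⟨ tabulate-cong suc-toℕ-mod ⟩
  tabulate Fin.suc                      ≡⟨ nonzeroElems-suc n ⟨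
  nonzeroElems (suc n)                  ∎
  where
  open ≡-Reasoning
  suc-toℕ-mod : ∀ i → suc (toℕ i) mod suc n ≡ Fin.suc i
  suc-toℕ-mod i = toℕ-injective (trans (toℕ-fromℕ< _) (m<n⇒m%n≡m (s<s (toℕ<n i))))

theorem2p7 : ∀ {m : ℕ} (G : Graph m) (b : Fin m → Fin (suc (nEdges G)))
    → IsBetaValuation G b
    → ∃ λ (A : Fin m → List (Fin (suc (nEdges G))))
        → IsEDF (suc (nEdges G)) 1 1 (natOrient G b) A
theorem2p7 G b (inj , labels↭[1,n]) =
  (λ v → [ b v ]) , (λ v → refl , [] ∷ []) , singletons-disjoint b inj , differences
  where
  n : ℕ
  n = nEdges G
  differences :
    concatMap (λ a → Δ [ b (proj₂ a) ] [ b (proj₁ a) ]) (arcs (natOrient G b))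
      ↭ concat (replicate 1 (nonzeroElems (suc n)))
  differences = begin
    concatMap (λ a → Δ [ b (proj₂ a) ] [ b (proj₁ a) ]) (map (orientEdge b) (edges G))
      ≡⟨ Δ-singletons-orientEdge b (edges G) ⟩
    map (_mod suc n) (map (edgeLabel b) (edges G))
      ↭⟨ map⁺ (_mod suc n) labels↭[1,n] ⟩
    map (_mod suc n) (map suc (upTo n))
      ≡⟨ map-mod-suc-upTo≡nonzeroElems n ⟩
    nonzeroElems (suc n)
      ≡⟨ ++-identityʳ _ ⟨
    nonzeroElems (suc n) ++ [] ∎
    where open PermutationReasoning
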